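{- Let $m,n$ be positive integers with $m\neq n$ and $\gcd(m,n)>1$. Then the tensor product $K_m\otimes K_n$ is not a circulant graph.
   Context: $K_m$ denotes the complete graph (no loops) on $m$ vertices. The tensor product $G\otimes H$ of graphs $G,H$ has vertex set $V(G)\times V(H)$, with $(g,h)$ adjacent to $(g',h')$ iff $g$ is adjacent to $g'$ in $G$ and $h$ is adjacent to $h'$ in $H$. A graph on $N$ vertices is circulant if its vertices can be labeled by $\mathbb{Z}_N$ so that, for some set $S\subseteq\mathbb{Z}_N$ with $S=-S$, vertices $i$ and $j$ are adjacent iff $j-i\in S \pmod N$ (equivalently, its automorphism group contains a cyclic subgroup acting transitively on the vertices). -}

module Defs where

open import Level using (Level; 0ℓ; suc; _⊔_)
open import Data.Nat using (ℕ; _+_; _*_; _∸_; NonZero)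
open import Data.Nat.DivMod using (_%_)
open import Data.Fin using (Fin; toℕ)
open import Data.Product using (_×_; _,_; Σ; ∃)
open import Relation.Binary.PropositionalEquality using (_≡_; _≢_)
open import Relation.Unary using (Pred)
open import Function.Bundles using (_↔_; Inverse)
open import Function.Bundles using (_⇔_)

record Graph (V : Set) : Set₁ where
  field
    Adj : V → V → Set

open Graph public

K : (m : ℕ) → Graph (Fin m)
K m = record { Adj = λ i j → i ≢ j }

_⊗_ : {V W : Set} → Graph V → Graph W → Graph (V × W)
G ⊗ H = record { Adj = λ { (g , h) (g' , h') → Adj G g g' × Adj H h h' } }

-- Difference j - i in ℤ_N, computed on representatives in {0,…,N-1}.
diffMod : (N : ℕ) .{{_ : NonZero N}} → ℕ → ℕ → ℕ
diffMod N j i = (j + (N ∸ i)) % N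

negMod : (N : ℕ) .{{_ : NonZero N}} → ℕ → ℕ
negMod N s = (N ∸ s) % N

-- A graph on N vertices (N ≥ 1) is circulant if its vertices can be labelled
-- by ℤ_N = {0,…,N-1} via a bijection so that, for some S ⊆ ℤ_N with S = -S,
-- vertices labelled i and j are adjacent iff (j - i mod N) ∈ S.
IsCirculant : {V : Set} (N : ℕ) .{{_ : NonZero N}} → Graph V → Set₁
IsCirculant {V} N G =
  Σ (Fin N ↔ V) λ f →
  Σ (Pred ℕ 0ℓ) λ S →
    (∀ s → S s → S (negMod N s)) ×
    (∀ (i j : Fin N) →
       Adj G (Inverse.to f i) (Inverse.to f j) ⇔ S (diffMod N (toℕ j) (toℕ i)))

module Submission where

-- Rotating ℤ_N is an automorphism of any circulant graph on ℤ_N. Two distinct vertices of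
-- K_a ⊗ K_b are non-adjacent iff they lie in a common row or column of the a × b grid, so an
-- automorphism preserves collinearity. If one split a row, it would map that row (b points)
-- injectively into a column (a points), and its inverse would do the opposite, forcing a = b.
-- Hence for a ≠ b rotations permute the rows, which makes the row of 0 a subgroup of ℤ_N of
-- index a, i.e. the multiples of a; likewise the column of 0 consists of the multiples of b.
-- Since gcd a b > 1, the nonzero residue lcm a b < ab is in both, so it labels the same vertex
-- as 0.

open import Defs
open import Level using (0ℓ)
open import Data.Nat using (ℕ; suc; pred; _+_; _*_; _∸_; _≤_; _<_; _>_; NonZero; >-nonZero; ≢-nonZero⁻¹)
open import Data.Nat.Properties hiding (_≟_)
open import Data.Nat.DivMod
open import Data.Nat.Divisibility using (_∣_; divides)
open import Data.Nat.GCD using (gcd)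
open import Data.Nat.LCM using (lcm; m∣lcm[m,n]; n∣lcm[m,n]; gcd*lcm)
open import Data.Nat.Tactic.RingSolver using (solve-∀)
open import Data.Fin using (Fin; toℕ) renaming (zero to fzero)
open import Data.Fin.Properties using (toℕ-fromℕ<; toℕ-injective; toℕ<n; injective⇒≤; pigeonhole; _≟_)
open import Data.Product using (_×_; _,_; proj₁; proj₂; ∃)
open import Data.Product.Algebra using (×-comm)
open import Data.Sum using (_⊎_; inj₁; inj₂)
import Data.Sum as Sum
open import Data.Empty using (⊥)
open import Function using (_∘_; _on_)
open import Function.Bundles using (_↔_; Inverse; Injection; mk↔ₛ′; _⇔_; Equivalence)
open import Function.Construct.Composition using (_↔-∘_)
open import Function.Definitions using (Injective)
open import Function.Properties.Inverse using (↔-sym; ↔⇒↣)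
open import Relation.Binary using (Rel; _Preserves_⟶_)
open import Relation.Binary.PropositionalEquality
open import Relation.Nullary using (¬_; yes; no; contradiction)
open import Relation.Unary using (Pred)

open Inverse using (to; from; strictlyInverseˡ; strictlyInverseʳ)
open ≡-Reasoning

module _ {d : ℕ} .{{_ : NonZero d}} where

  %-+-congʳ : ∀ {m n} k → m % d ≡ n % d → (m + k) % d ≡ (n + k) % d
  %-+-congʳ {m} {n} k eq = begin
    (m + k) % d           ≡⟨ %-distribˡ-+ m k d ⟩
    (m % d + k % d) % d   ≡⟨ cong (λ r → (r + k % d) % d) eq ⟩
    (n % d + k % d) % d   ≡⟨ %-distribˡ-+ n k d ⟨
    (n + k) % d           ∎

  %-+-congˡ : ∀ {m n} k → m % d ≡ n % d → (k + m) % d ≡ (k + n) % d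
  %-+-congˡ {m} {n} k eq = begin
    (k + m) % d   ≡⟨ %-congˡ (+-comm k m) ⟩
    (m + k) % d   ≡⟨ %-+-congʳ k eq ⟩
    (n + k) % d   ≡⟨ %-congˡ (+-comm n k) ⟩
    (k + n) % d   ∎

  [m%d+n]%d≡[m+n]%d : ∀ m n → (m % d + n) % d ≡ (m + n) % d
  [m%d+n]%d≡[m+n]%d m n = %-+-congʳ n (m%n%n≡m%n m d)

  %-+-cancelˡ : ∀ k {m n} → (k + m) % d ≡ (k + n) % d → m % d ≡ n % d
  %-+-cancelˡ k {m} {n} eq = begin
    m % d                        ≡⟨ [m+kn]%n≡m%n m k d ⟨
    (m + k * d) % d              ≡⟨ %-congˡ (regroup m) ⟩
    (k * pred d + (k + m)) % d   ≡⟨ %-+-congˡ (k * pred d) eq ⟩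
    (k * pred d + (k + n)) % d   ≡⟨ %-congˡ (regroup n) ⟨
    (n + k * d) % d              ≡⟨ [m+kn]%n≡m%n n k d ⟩
    n % d                        ∎
    where
    regroup : ∀ x → x + k * d ≡ k * pred d + (k + x)
    regroup x = begin
      x + k * d                ≡⟨ cong (λ e → x + k * e) (suc-pred d) ⟨
      x + k * suc (pred d)     ≡⟨ cong (x +_) (*-suc k (pred d)) ⟩
      x + (k + k * pred d)     ≡⟨ +-comm x _ ⟩
      k + k * pred d + x       ≡⟨ cong (_+ x) (+-comm k _) ⟩
      k * pred d + k + x       ≡⟨ +-assoc (k * pred d) k x ⟩
      k * pred d + (k + x)     ∎

  toℕ-mod : ∀ x → toℕ (x mod d) ≡ x % d
  toℕ-mod x = toℕ-fromℕ< (m%n<n x d)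

  mod-cong : ∀ {x y} → x % d ≡ y % d → x mod d ≡ y mod d
  mod-cong {x} {y} eq = toℕ-injective (trans (toℕ-mod x) (trans eq (sym (toℕ-mod y))))

  toℕ-mod-inverse : ∀ i → toℕ i mod d ≡ i
  toℕ-mod-inverse i = toℕ-injective (trans (toℕ-mod (toℕ i)) (m<n⇒m%n≡m (toℕ<n i)))

diffMod-spec : ∀ N .{{_ : NonZero N}} {i} j → i ≤ N → (i + diffMod N j i) % N ≡ j % N
diffMod-spec N {i} j i≤N = begin
  (i + (j + (N ∸ i)) % N) % N   ≡⟨ %-+-congˡ i (m%n%n≡m%n (j + (N ∸ i)) N) ⟩
  (i + (j + (N ∸ i))) % N       ≡⟨ %-congˡ (swap-summands i j (N ∸ i)) ⟩
  (j + (i + (N ∸ i))) % N       ≡⟨ %-congˡ (cong (j +_) (m+[n∸m]≡n i≤N)) ⟩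
  (j + N) % N                   ≡⟨ [m+n]%n≡m%n j N ⟩
  j % N                         ∎
  where
  swap-summands : ∀ x y z → x + (y + z) ≡ y + (x + z)
  swap-summands = solve-∀

module Rotation (N : ℕ) .{{_ : NonZero N}} where

  rotate : ℕ → Fin N → Fin N
  rotate k i = (toℕ i + k) mod N

  rotate-mod : ∀ k x → rotate k (x mod N) ≡ (x + k) mod N
  rotate-mod k x = mod-cong (trans (cong (λ r → (r + k) % N) (toℕ-mod x)) ([m%d+n]%d≡[m+n]%d x k))

  rotate-rotate-cancel : ∀ {k j} t → k + j ≡ t * N → ∀ i → rotate j (rotate k i) ≡ i
  rotate-rotate-cancel {k} {j} t k+j≡tN i = begin
    rotate j (rotate k i)    ≡⟨ rotate-mod j (toℕ i + k) ⟩
    (toℕ i + k + j) mod N    ≡⟨ cong (_mod N) (trans (+-assoc (toℕ i) k j) (cong (toℕ i +_) k+j≡tN)) ⟩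
    (toℕ i + t * N) mod N    ≡⟨ mod-cong ([m+kn]%n≡m%n (toℕ i) t N) ⟩
    toℕ i mod N              ≡⟨ toℕ-mod-inverse i ⟩
    i                        ∎

  rotation : ℕ → Fin N ↔ Fin N
  rotation k = mk↔ₛ′ (rotate k) (rotate (k * pred N))
    (rotate-rotate-cancel k (trans (+-comm _ k) k+k[N-1]≡kN))
    (rotate-rotate-cancel k k+k[N-1]≡kN)
    where
    k+k[N-1]≡kN : k + k * pred N ≡ k * N
    k+k[N-1]≡kN = trans (sym (*-suc k (pred N))) (cong (k *_) (suc-pred N))

  diffMod-rotate : ∀ k (i j : Fin N) →
    diffMod N (toℕ (rotate k j)) (toℕ (rotate k i)) ≡ diffMod N (toℕ j) (toℕ i)
  diffMod-rotate k i j = begin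
    D′       ≡⟨ m%n%n≡m%n (j′ + (N ∸ i′)) N ⟨
    D′ % N   ≡⟨ %-+-cancelˡ (toℕ i + k) same-endpoint ⟩
    D % N    ≡⟨ m%n%n≡m%n (toℕ j + (N ∸ toℕ i)) N ⟩
    D        ∎
    where
    i′ = toℕ (rotate k i)
    j′ = toℕ (rotate k j)
    D′ = diffMod N j′ i′
    D  = diffMod N (toℕ j) (toℕ i)

    same-endpoint : (toℕ i + k + D′) % N ≡ (toℕ i + k + D) % N
    same-endpoint = begin
      (toℕ i + k + D′) % N          ≡⟨ [m%d+n]%d≡[m+n]%d (toℕ i + k) D′ ⟨
      ((toℕ i + k) % N + D′) % N    ≡⟨ cong (λ r → (r + D′) % N) (toℕ-mod (toℕ i + k)) ⟨
      (i′ + D′) % N                 ≡⟨ diffMod-spec N j′ (<⇒≤ (toℕ<n (rotate k i))) ⟩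
      j′ % N                        ≡⟨ cong (_% N) (toℕ-mod (toℕ j + k)) ⟩
      (toℕ j + k) % N % N           ≡⟨ m%n%n≡m%n (toℕ j + k) N ⟩
      (toℕ j + k) % N               ≡⟨ %-+-congʳ k (diffMod-spec N (toℕ j) (<⇒≤ (toℕ<n i))) ⟨
      (toℕ i + D + k) % N           ≡⟨ %-congˡ (+-right-comm (toℕ i) D k) ⟩
      (toℕ i + k + D) % N           ∎
      where
      +-right-comm : ∀ x y z → x + y + z ≡ x + z + y
      +-right-comm = solve-∀

module Grid {V : Set} {a b : ℕ} (e : V ↔ (Fin a × Fin b)) where

  row : V → Fin a
  row x = proj₁ (to e x)

  col : V → Fin b
  col x = proj₂ (to e x)

  point : Fin a → Fin b → V
  point α β = from e (α , β)

  row-point : ∀ α β → row (point α β) ≡ α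
  row-point α β = cong proj₁ (strictlyInverseˡ e (α , β))

  col-point : ∀ α β → col (point α β) ≡ β
  col-point α β = cong proj₂ (strictlyInverseˡ e (α , β))

  row-col-injective : ∀ {x y} → row x ≡ row y → col x ≡ col y → x ≡ y
  row-col-injective r c = Injection.injective (↔⇒↣ e) (cong₂ _,_ r c)

  Collinear : Rel V 0ℓ
  Collinear x y = row x ≡ row y ⊎ col x ≡ col y

  Adjacent : Rel V 0ℓ
  Adjacent x y = Adj (K a ⊗ K b) (to e x) (to e y)

  collinear⊎adjacent : ∀ x y → Collinear x y ⊎ Adjacent x y
  collinear⊎adjacent x y with row x ≟ row y | col x ≟ col y
  ... | yes r | _     = inj₁ (inj₁ r)
  ... | no _  | yes c = inj₁ (inj₂ c)
  ... | no r  | no c  = inj₂ (r , c)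

  collinear⇒¬adjacent : ∀ {x y} → Collinear x y → ¬ Adjacent x y
  collinear⇒¬adjacent (inj₁ r) (r≢ , _) = r≢ r
  collinear⇒¬adjacent (inj₂ c) (_ , c≢) = c≢ c

  reflects-adjacency⇒preserves-collinearity : ∀ {σ : V → V} →
    (∀ {x y} → Adjacent (σ x) (σ y) → Adjacent x y) → σ Preserves Collinear ⟶ Collinear
  reflects-adjacency⇒preserves-collinearity {σ} reflect {x} {y} c with collinear⊎adjacent (σ x) (σ y)
  ... | inj₁ c′  = c′
  ... | inj₂ adj = contradiction (reflect adj) (collinear⇒¬adjacent c)

  collinear-row≢⇒col≡ : ∀ {x y} → Collinear x y → row x ≢ row y → col x ≡ col y
  collinear-row≢⇒col≡ (inj₁ r) r≢ = contradiction r r≢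
  collinear-row≢⇒col≡ (inj₂ c) _  = c

  splitting-a-row⇒≤ : ∀ {σ : V → V} → Injective _≡_ _≡_ σ → σ Preserves Collinear ⟶ Collinear →
    ∀ {x y} → row x ≡ row y → row (σ x) ≢ row (σ y) → b ≤ a
  splitting-a-row⇒≤ {σ} σ-injective σ-collinear {x} {y} rx≡ry split =
    injective⇒≤ {f = row ∘ σ ∘ point (row x)} image-injective
    where
    σx-σy-col : col (σ x) ≡ col (σ y)
    σx-σy-col = collinear-row≢⇒col≡ (σ-collinear (inj₁ rx≡ry)) split

    row-into-column : ∀ {z} → row z ≡ row x → col (σ z) ≡ col (σ x)
    row-into-column {z} rz≡rx with σ-collinear (inj₁ (sym rz≡rx))
    ... | inj₂ c = sym c
    ... | inj₁ r with σ-collinear (inj₁ (trans (sym rx≡ry) (sym rz≡rx)))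
    ...   | inj₁ r′ = contradiction (trans r (sym r′)) split
    ...   | inj₂ c′ = trans (sym c′) (sym σx-σy-col)

    image-injective : Injective _≡_ _≡_ (row ∘ σ ∘ point (row x))
    image-injective {β} {β′} eq = begin
      β                        ≡⟨ col-point (row x) β ⟨
      col (point (row x) β)    ≡⟨ cong col (σ-injective (row-col-injective eq same-col)) ⟩
      col (point (row x) β′)   ≡⟨ col-point (row x) β′ ⟩
      β′                       ∎
      where
      same-col : col (σ (point (row x) β)) ≡ col (σ (point (row x) β′))
      same-col = trans (row-into-column (row-point _ β)) (sym (row-into-column (row-point _ β′)))

module _ {V : Set} {a b : ℕ} (e : V ↔ (Fin a × Fin b)) where
  open Grid e
  private module Transposed = Grid (×-comm (Fin a) (Fin b) ↔-∘ e)

  automorphism-preserves-rows : a ≢ b → (σ : V ↔ V) →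
    to σ Preserves Collinear ⟶ Collinear → from σ Preserves Collinear ⟶ Collinear →
    to σ Preserves (_≡_ on row) ⟶ (_≡_ on row)
  automorphism-preserves-rows a≢b σ σ-collinear σ⁻¹-collinear {x} {y} rx≡ry
    with row (to σ x) ≟ row (to σ y)
  ... | yes r     = r
  ... | no split = contradiction (≤-antisym a≤b b≤a) a≢b
    where
    b≤a : b ≤ a
    b≤a = splitting-a-row⇒≤ (Injection.injective (↔⇒↣ σ)) σ-collinear rx≡ry split

    col-split : col (from σ (to σ x)) ≢ col (from σ (to σ y))
    col-split c = split (cong (row ∘ to σ) (row-col-injective rx≡ry
      (subst₂ (λ u v → col u ≡ col v) (strictlyInverseʳ σ x) (strictlyInverseʳ σ y) c)))

    a≤b : a ≤ b
    a≤b = Transposed.splitting-a-row⇒≤ (Injection.injective (↔⇒↣ (↔-sym σ)))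
      (λ c → Sum.swap (σ⁻¹-collinear (Sum.swap c)))
      (collinear-row≢⇒col≡ (σ-collinear (inj₁ rx≡ry)) split) col-split

module RotationInvariantColouring {N c : ℕ} .{{_ : NonZero N}} (colour : Fin N → Fin c)
  (invariant : ∀ k → Rotation.rotate N k Preserves (_≡_ on colour) ⟶ (_≡_ on colour))
  (surjective : ∀ γ → ∃ λ i → colour i ≡ γ) where
  open Rotation N

  private
    colourOf : ℕ → Fin c
    colourOf x = colour (x mod N)

    Period : ℕ → Set
    Period r = colourOf r ≡ colourOf 0

    colourOf-+ : ∀ k {x y} → colourOf x ≡ colourOf y → colourOf (x + k) ≡ colourOf (y + k)
    colourOf-+ k {x} {y} eq = begin
      colourOf (x + k)              ≡⟨ cong colour (rotate-mod k x) ⟨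
      colour (rotate k (x mod N))   ≡⟨ invariant k eq ⟩
      colour (rotate k (y mod N))   ≡⟨ cong colour (rotate-mod k y) ⟩
      colourOf (y + k)              ∎

    colourOf-+-cancel : ∀ k {x y} → colourOf (x + k) ≡ colourOf (y + k) → colourOf x ≡ colourOf y
    colourOf-+-cancel k {x} {y} eq = begin
      colour (x mod N)                                   ≡⟨ cong colour (strictlyInverseʳ (rotation k) (x mod N)) ⟨
      colour (from (rotation k) (rotate k (x mod N)))    ≡⟨ invariant (k * pred N) rotated ⟩
      colour (from (rotation k) (rotate k (y mod N)))    ≡⟨ cong colour (strictlyInverseʳ (rotation k) (y mod N)) ⟩
      colour (y mod N)                                   ∎
      where
      rotated : colour (rotate k (x mod N)) ≡ colour (rotate k (y mod N))
      rotated = subst₂ (λ u v → colour u ≡ colour v) (sym (rotate-mod k x)) (sym (rotate-mod k y)) eq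

    period-+ : ∀ {r} → Period r → ∀ x → colourOf (x + r) ≡ colourOf x
    period-+ {r} period x = trans (cong colourOf (+-comm x r)) (colourOf-+ x period)

    period-* : ∀ {r} → Period r → ∀ t x → colourOf (x + t * r) ≡ colourOf x
    period-* period 0 x = cong colourOf (+-identityʳ x)
    period-* {r} period (suc t) x = begin
      colourOf (x + (r + t * r))   ≡⟨ cong colourOf (trans (cong (x +_) (+-comm r _)) (sym (+-assoc x _ r))) ⟩
      colourOf (x + t * r + r)     ≡⟨ period-+ period (x + t * r) ⟩
      colourOf (x + t * r)         ≡⟨ period-* period t x ⟩
      colourOf x                   ∎

    period-% : ∀ {r} .{{_ : NonZero r}} → Period r → ∀ x → colourOf (x % r) ≡ colourOf x
    period-% {r} period x =
      trans (sym (period-* period (x / r) (x % r))) (cong colourOf (sym (m≡m%n+[m/n]*n x r)))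

    colours≤period : ∀ {r} → 0 < r → Period r → c ≤ r
    colours≤period {r} 0<r period = injective⇒≤ {f = λ γ → representative γ mod r} injective
      where
      instance _ = >-nonZero 0<r
      representative : Fin c → ℕ
      representative γ = toℕ (proj₁ (surjective γ))

      colourOf-representative : ∀ γ → colourOf (representative γ) ≡ γ
      colourOf-representative γ =
        trans (cong colour (toℕ-mod-inverse (proj₁ (surjective γ)))) (proj₂ (surjective γ))

      injective : Injective _≡_ _≡_ (λ γ → representative γ mod r)
      injective {γ} {δ} eq = begin
        γ                                   ≡⟨ colourOf-representative γ ⟨
        colourOf (representative γ)         ≡⟨ period-% period _ ⟨
        colourOf (representative γ % r)     ≡⟨ cong colourOf same-residue ⟩
        colourOf (representative δ % r)     ≡⟨ period-% period _ ⟩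
        colourOf (representative δ)         ≡⟨ colourOf-representative δ ⟩
        δ                                   ∎
        where
        same-residue : representative γ % r ≡ representative δ % r
        same-residue = trans (sym (toℕ-mod _)) (trans (cong toℕ eq) (toℕ-mod _))

    short-period : ∃ λ r → 0 < r × r ≤ c × Period r
    short-period with pigeonhole (n<1+n c) (colourOf ∘ toℕ)
    ... | i , j , i<j , same =
      toℕ j ∸ toℕ i , m<n⇒0<n∸m i<j , ≤-trans (m∸n≤m (toℕ j) (toℕ i)) (≤-pred (toℕ<n j)) ,
      colourOf-+-cancel (toℕ i) (trans (cong colourOf (m∸n+n≡m {toℕ j} {toℕ i} (<⇒≤ i<j))) (sym same))

    period-c : Period c
    period-c with short-period
    ... | r , 0<r , r≤c , period = subst Period (≤-antisym r≤c (colours≤period 0<r period)) period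

  ∣⇒same-colour-as-0 : ∀ {x} → c ∣ x → colour (x mod N) ≡ colour (0 mod N)
  ∣⇒same-colour-as-0 (divides t refl) = period-* period-c t 0

0<lcm : ∀ m n .{{_ : NonZero m}} .{{_ : NonZero n}} → 0 < lcm m n
0<lcm m n = n≢0⇒n>0 λ lcm≡0 → ≢-nonZero⁻¹ (m * n) {{m*n≢0 m n}}
  (trans (sym (gcd*lcm m n)) (trans (cong (gcd m n *_) lcm≡0) (*-zeroʳ (gcd m n))))

lcm<* : ∀ m n .{{_ : NonZero m}} .{{_ : NonZero n}} → 1 < gcd m n → lcm m n < m * n
lcm<* m n 1<gcd = subst (lcm m n <_) (trans (*-comm (lcm m n) (gcd m n)) (gcd*lcm m n))
  (m<m*n (lcm m n) (gcd m n) {{>-nonZero (0<lcm m n)}} 1<gcd)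

module NotCirculant (m n : ℕ) (m≢n : suc m ≢ suc n) (1<gcd : gcd (suc m) (suc n) > 1)
  (f : Fin (suc m * suc n) ↔ (Fin (suc m) × Fin (suc n))) (S : Pred ℕ 0ℓ)
  (circulant : ∀ i j → Adj (K (suc m) ⊗ K (suc n)) (to f i) (to f j)
                         ⇔ S (diffMod (suc m * suc n) (toℕ j) (toℕ i))) where

  N : ℕ
  N = suc m * suc n

  open Grid f
  open Rotation N

  rotate-reflects-adjacency : ∀ k {i j} → Adjacent (rotate k i) (rotate k j) → Adjacent i j
  rotate-reflects-adjacency k {i} {j} adj = Equivalence.from (circulant i j)
    (subst S (diffMod-rotate k i j) (Equivalence.to (circulant (rotate k i) (rotate k j)) adj))

  rotate-preserves-collinearity : ∀ k → rotate k Preserves Collinear ⟶ Collinear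
  rotate-preserves-collinearity k = reflects-adjacency⇒preserves-collinearity (rotate-reflects-adjacency k)

  rotate-preserves-rows : ∀ k → rotate k Preserves (_≡_ on row) ⟶ (_≡_ on row)
  rotate-preserves-rows k = automorphism-preserves-rows f m≢n (rotation k)
    (rotate-preserves-collinearity k) (rotate-preserves-collinearity (k * pred N))

  rotate-preserves-columns : ∀ k → rotate k Preserves (_≡_ on col) ⟶ (_≡_ on col)
  rotate-preserves-columns k = automorphism-preserves-rows (×-comm _ _ ↔-∘ f) (≢-sym m≢n) (rotation k)
    (λ c → Sum.swap (rotate-preserves-collinearity k (Sum.swap c)))
    (λ c → Sum.swap (rotate-preserves-collinearity (k * pred N) (Sum.swap c)))

  module Rows = RotationInvariantColouring row rotate-preserves-rows
    (λ α → point α fzero , row-point α fzero)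
  module Columns = RotationInvariantColouring col rotate-preserves-columns
    (λ β → point fzero β , col-point fzero β)

  absurd : ⊥
  absurd = contradiction L≡0 (≢-nonZero⁻¹ L {{>-nonZero (0<lcm (suc m) (suc n))}})
    where
    L = lcm (suc m) (suc n)

    L≡0[N] : L mod N ≡ 0 mod N
    L≡0[N] = row-col-injective (Rows.∣⇒same-colour-as-0 (m∣lcm[m,n] (suc m) (suc n)))
                               (Columns.∣⇒same-colour-as-0 (n∣lcm[m,n] (suc m) (suc n)))

    L≡0 : L ≡ 0
    L≡0 = begin
      L               ≡⟨ m<n⇒m%n≡m (lcm<* (suc m) (suc n) 1<gcd) ⟨
      L % N           ≡⟨ toℕ-mod L ⟨
      toℕ (L mod N)   ≡⟨ cong toℕ L≡0[N] ⟩
      0               ∎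

lemma3 : (m n : ℕ) → suc m ≢ suc n → gcd (suc m) (suc n) > 1 →
    ¬ IsCirculant (suc m * suc n) (K (suc m) ⊗ K (suc n))
lemma3 m n m≢n 1<gcd (f , S , _ , circulant) = NotCirculant.absurd m n m≢n 1<gcd f S circulant
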